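{- Let $s$ be a status of a safe register LTS for a register $r$ that is reachable from its initial status, and let $t\in\mathbb T$. If $t\in\mathit{rds}(s)$ and $\mathit{wrts}(s)\neq\emptyset$, then $\mathit{ovrl}(s,t)=\mathit{true}$.
   Context: Fix a finite set $\mathbb T$ of thread ids and a register $r$ with finite domain $D_r$ and initial value $d^0_r$. The actions are $\mathit{sr}_{t,r}$ (start read), $\mathit{fr}_{t,r}(d)$ (finish read returning $d$), $\mathit{sw}_{t,r}(d)$ (start write of $d$), $\mathit{fw}_{t,r}$ (finish write), for $t\in\mathbb T$, $d\in D_r$. States of the register LTS are statuses $s$ with components $\mathit{stor}(s)\in D_r$, $\mathit{rds}(s),\mathit{wrts}(s),\mathit{pend}(s)\subseteq\mathbb T$, and per $t$: $\mathit{rec}(s,t)\in D_r$, $\mathit{ovrl}(s,t)\in\{\mathit{true},\mathit{false}\}$, $\mathit{posv}(s,t)\subseteq D_r$; the initial status has $\mathit{stor}=d^0_r$, $\mathit{rds}=\mathit{wrts}=\mathit{pend}=\emptyset$, $\mathit{rec}(t)=d^0_r$, $\mathit{ovrl}(t)=\mathit{false}$, $\mathit{posv}(t)=\emptyset$. Updates (unmentioned components unchanged, right sides evaluated in $s$): $\mathit{usr}(s,t)$: add $t$ to $\mathit{rds}$ and $\mathit{pend}$; $\mathit{ovrl}(t):=(\mathit{wrts}(s)\neq\emptyset)$; $\mathit{posv}(t):=\{\mathit{stor}(s)\}\cup\{\mathit{rec}(s,t'):t'\in\mathit{wrts}(s)\}$. $\mathit{ufr}(s,t)$: remove $t$ from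 $\mathit{rds}$. $\mathit{usw}(s,t,d)$: add $t$ to $\mathit{wrts}$ and $\mathit{pend}$; $\mathit{rec}(t):=d$; $\mathit{ovrl}(t):=(\mathit{wrts}(s)\neq\emptyset)$; for all $t'\neq t$: $\mathit{ovrl}(t'):=\mathit{true}$, $\mathit{posv}(t'):=\mathit{posv}(s,t')\cup\{d\}$. $\mathit{ufw}(s,t,d)$: $\mathit{stor}:=d$, remove $t$ from $\mathit{wrts}$. The safe register LTS has, for every status $s$, $t\in\mathbb T$, $d\in D_r$, the transitions: if $t\notin\mathit{rds}(s)\cup\mathit{wrts}(s)$: $s\xrightarrow{\mathit{sr}_{t,r}}\mathit{usr}(s,t)$ and $s\xrightarrow{\mathit{sw}_{t,r}(d)}\mathit{usw}(s,t,d)$; if $t\in\mathit{rds}(s)$ and $\neg\mathit{ovrl}(s,t)$: $s\xrightarrow{\mathit{fr}_{t,r}(\mathit{stor}(s))}\mathit{ufr}(s,t)$; if $t\in\mathit{rds}(s)$ and $\mathit{ovrl}(s,t)$: $s\xrightarrow{\mathit{fr}_{t,r}(d)}\mathit{ufr}(s,t)$; if $t\in\mathit{wrts}(s)$ and $\neg\mathit{ovrl}(s,t)$: $s\xrightarrow{\mathit{fw}_{t,r}}\mathit{ufw}(s,t,\mathit{rec}(s,t))$; if $t\in\mathit{wrts}(s)$ and $\mathit{ovrl}(s,t)$: $s\xrightarrow{\mathit{fw}_{t,r}}\mathit{ufw}(s,t,d)$. -}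

module Defs where

open import Data.Nat using (ℕ)
open import Data.Fin using (Fin; _≟_)
open import Data.Bool using (Bool; true; false; _∨_; if_then_else_)
open import Data.Product using (∃; _×_; _,_)
open import Relation.Nullary using (¬_; does)
open import Relation.Binary.PropositionalEquality using (_≡_)

-- Threads 𝕋 are modelled as Fin nT, register domain D_r as Fin nD.
-- Subsets are characteristic functions into Bool.

module SafeRegister (nT nD : ℕ) (d⁰ : Fin nD) where

  Thread : Set
  Thread = Fin nT

  Val : Set
  Val = Fin nD

  record Status : Set where
    constructor status
    field
      stor : Val
      rds  : Thread → Bool
      wrts : Thread → Bool
      pend : Thread → Bool
      rec  : Thread → Val
      ovrl : Thread → Bool
      posv : Thread → Val → Bool
  open Status public

  _∈ˢ_ : Thread → (Thread → Bool) → Set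
  t ∈ˢ X = X t ≡ true

  NonEmpty : (Thread → Bool) → Set
  NonEmpty X = ∃ λ t → X t ≡ true

  anyᵀ : ∀ {k} → (Fin k → Bool) → Bool
  anyᵀ {ℕ.zero}  X = false
  anyᵀ {ℕ.suc k} X = X Fin.zero ∨ anyᵀ {k} (λ i → X (Fin.suc i))

  eqᵇ : ∀ {k} → Fin k → Fin k → Bool
  eqᵇ a b = does (a ≟ b)

  initial : Status
  initial = status d⁰ (λ _ → false) (λ _ → false) (λ _ → false)
                   (λ _ → d⁰) (λ _ → false) (λ _ _ → false)

  usr : Status → Thread → Status
  usr s t = status (stor s)
    (λ t' → eqᵇ t' t ∨ rds s t')
    (wrts s)
    (λ t' → eqᵇ t' t ∨ pend s t')
    (rec s)
    (λ t' → if eqᵇ t' t then anyᵀ (wrts s) else ovrl s t')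
    (λ t' → if eqᵇ t' t
              then (λ d → eqᵇ d (stor s) ∨ anyᵀ (λ u → wrts s u Data.Bool.∧ eqᵇ d (rec s u)))
              else posv s t')

  ufr : Status → Thread → Status
  ufr s t = status (stor s)
    (λ t' → if eqᵇ t' t then false else rds s t')
    (wrts s) (pend s) (rec s) (ovrl s) (posv s)

  usw : Status → Thread → Val → Status
  usw s t d = status (stor s)
    (rds s)
    (λ t' → eqᵇ t' t ∨ wrts s t')
    (λ t' → eqᵇ t' t ∨ pend s t')
    (λ t' → if eqᵇ t' t then d else rec s t')
    (λ t' → if eqᵇ t' t then anyᵀ (wrts s) else true)
    (λ t' → if eqᵇ t' t then posv s t' else (λ e → posv s t' e ∨ eqᵇ e d))

  ufw : Status → Thread → Val → Status
  ufw s t d = status d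
    (rds s)
    (λ t' → if eqᵇ t' t then false else wrts s t')
    (pend s) (rec s) (ovrl s) (posv s)

  data Action : Set where
    sr : Thread → Action
    fr : Thread → Val → Action
    sw : Thread → Val → Action
    fw : Thread → Action

  data _—[_]→_ : Status → Action → Status → Set where
    start-read  : ∀ {s t} → rds s t ≡ false → wrts s t ≡ false →
                  s —[ sr t ]→ usr s t
    start-write : ∀ {s t d} → rds s t ≡ false → wrts s t ≡ false →
                  s —[ sw t d ]→ usw s t d
    finish-read-no  : ∀ {s t} → rds s t ≡ true → ovrl s t ≡ false →
                  s —[ fr t (stor s) ]→ ufr s t
    finish-read-ov  : ∀ {s t d} → rds s t ≡ true → ovrl s t ≡ true →
                  s —[ fr t d ]→ ufr s t
    finish-write-no : ∀ {s t} → wrts s t ≡ true → ovrl s t ≡ false →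
                  s —[ fw t ]→ ufw s t (rec s t)
    finish-write-ov : ∀ {s t d} → wrts s t ≡ true → ovrl s t ≡ true →
                  s —[ fw t ]→ ufw s t d

  data Reachable : Status → Set where
    init : Reachable initial
    step : ∀ {s a s'} → Reachable s → s —[ a ]→ s' → Reachable s'

-- Every reader either started while some write was already running, and so recorded
-- an overlap, or was already reading when a write started, and every start of a write
-- sets the overlap flag of all other threads.  Finishing operations only shrink rds and
-- wrts and never touch ovrl, so "every reader overlaps every writer" is an invariant.
module Submission where

open import Defs
open import Data.Nat using (ℕ)
open import Data.Fin using (Fin; zero; suc; _≟_)
open import Data.Bool using (Bool; true)
open import Data.Bool.Properties using (∨-zeroʳ)
open import Data.Product using (_,_)
open import Relation.Nullary using (yes; no)
open import Relation.Binary.PropositionalEquality using (_≡_; refl; sym; trans)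

module _ {nT nD : ℕ} {d⁰ : Fin nD} where
  open SafeRegister nT nD d⁰

  anyᵀ-complete : ∀ {k} (X : Fin k → Bool) (u : Fin k) → X u ≡ true → anyᵀ X ≡ true
  anyᵀ-complete X zero    Xu rewrite Xu = refl
  anyᵀ-complete X (suc u) Xu rewrite anyᵀ-complete (λ i → X (suc i)) u Xu = ∨-zeroʳ (X zero)

  ReadersOverlapWriters : Status → Set
  ReadersOverlapWriters s =
    ∀ t u → t ∈ˢ rds s → u ∈ˢ wrts s → ovrl s t ≡ true

  initial-readersOverlapWriters : ReadersOverlapWriters initial
  initial-readersOverlapWriters t u ()

  step-readersOverlapWriters : ∀ {s a s'} → s —[ a ]→ s' →
    ReadersOverlapWriters s → ReadersOverlapWriters s'
  step-readersOverlapWriters {s} (start-read {t = t} _ _) inv t' u t'∈rds u∈wrts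
    with t' ≟ t
  ... | yes refl = anyᵀ-complete (wrts s) u u∈wrts
  ... | no _     = inv t' u t'∈rds u∈wrts
  step-readersOverlapWriters (start-write {t = t} t∉rds _) inv t' u t'∈rds u∈wrts
    with t' ≟ t
  ... | yes refl with () ← trans (sym t'∈rds) t∉rds
  ... | no _     = refl
  step-readersOverlapWriters (finish-read-no {t = t} _ _) inv t' u t'∈rds u∈wrts
    with t' ≟ t
  ... | no _     = inv t' u t'∈rds u∈wrts
  step-readersOverlapWriters (finish-read-ov {t = t} _ _) inv t' u t'∈rds u∈wrts
    with t' ≟ t
  ... | no _     = inv t' u t'∈rds u∈wrts
  step-readersOverlapWriters (finish-write-no {t = t} _ _) inv t' u t'∈rds u∈wrts
    with u ≟ t
  ... | no _     = inv t' u t'∈rds u∈wrts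
  step-readersOverlapWriters (finish-write-ov {t = t} _ _) inv t' u t'∈rds u∈wrts
    with u ≟ t
  ... | no _     = inv t' u t'∈rds u∈wrts

  reachable⇒readersOverlapWriters : ∀ {s} → Reachable s → ReadersOverlapWriters s
  reachable⇒readersOverlapWriters init = initial-readersOverlapWriters
  reachable⇒readersOverlapWriters (step r tr) =
    step-readersOverlapWriters tr (reachable⇒readersOverlapWriters r)

lemma14 : (nT nD : ℕ) (d⁰ : Fin nD) →
    let open SafeRegister nT nD d⁰ in
    (s : Status) → Reachable s → (t : Thread) →
    rds s t ≡ true → NonEmpty (wrts s) → ovrl s t ≡ true
lemma14 nT nD d⁰ s r t t∈rds (u , u∈wrts) =
  reachable⇒readersOverlapWriters r t u t∈rds u∈wrts
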